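{- Let $n\ge 5$ and fix a red/blue coloring of the edges of the complete graph on $\{\pm1\}^n$. Then at most a $\frac{14}{15}$ fraction of all $2\times2$ squares have an odd number of red edges among their four sides.
   Context: For $v\in\{\pm1\}^n$ and $1\le i\le n$, $v\oplus i$ denotes $v$ with its $i$-th coordinate negated. A $2\times 2$ square is a set of four vertices $u$, $u\oplus i\oplus j$, $u\oplus k\oplus l$, $u\oplus i\oplus j\oplus k\oplus l$ with $i,j,k,l$ distinct coordinates; its four sides are the length-$2$ edges $\{u,u\oplus i\oplus j\}$, $\{u, u\oplus k\oplus l\}$, $\{u\oplus i\oplus j, u\oplus i\oplus j\oplus k\oplus l\}$, $\{u\oplus k\oplus l, u\oplus i\oplus j\oplus k\oplus l\}$. -}

module Defs where

open import Data.Bool using (Bool; true; false; not; _xor_; _∧_)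
open import Data.Nat using (ℕ; zero; suc)
open import Data.Fin using (Fin; _≟_)
open import Data.Vec using (Vec; []; _∷_; updateAt)
open import Data.List using (List; []; _∷_; [_]; concatMap; map; allFin; filterᵇ; length)
open import Data.Product using (_×_; _,_)
open import Relation.Nullary.Decidable using (⌊_⌋)

-- Vertices of the hypercube {±1}^n, encoded as Boolean vectors
-- (true ↔ -1, false ↔ +1; the encoding is immaterial).
V : ℕ → Set
V n = Vec Bool n

_⊕_ : ∀ {n} → V n → Fin n → V n
v ⊕ i = updateAt v i not

allV : (n : ℕ) → List (V n)
allV zero = [ [] ]
allV (suc n) = concatMap (λ v → (false ∷ v) ∷ (true ∷ v) ∷ []) (allV n)

distinct4 : ∀ {n} → Fin n → Fin n → Fin n → Fin n → Bool
distinct4 i j k l =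
  not (⌊ i ≟ j ⌋ Data.Bool.∨ ⌊ i ≟ k ⌋ Data.Bool.∨ ⌊ i ≟ l ⌋
       Data.Bool.∨ ⌊ j ≟ k ⌋ Data.Bool.∨ ⌊ j ≟ l ⌋ Data.Bool.∨ ⌊ k ≟ l ⌋)

-- A square datum (u, i, j, k, l) describes the 2×2 square
-- {u, u⊕i⊕j, u⊕k⊕l, u⊕i⊕j⊕k⊕l}.
SqDatum : ℕ → Set
SqDatum n = V n × Fin n × Fin n × Fin n × Fin n

-- Every 2×2 square (as a set of
-- four vertices) arises from exactly 32 such data (4 choices of base
-- vertex u, 8 orderings of the two index pairs), so fractions of squares
-- equal fractions of square data.
squareData : (n : ℕ) → List (SqDatum n)
squareData n =
  concatMap (λ u →
  concatMap (λ i →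
  concatMap (λ j →
  concatMap (λ k →
  map (λ l → (u , i , j , k , l))
      (filterᵇ (λ l → distinct4 i j k l) (allFin n)))
  (allFin n)) (allFin n)) (allFin n)) (allV n)

-- A red/blue coloring of the edges of the complete graph on V n:
-- a symmetric function c with c u v = true meaning the edge {u,v} is red.
-- (Values c u u are irrelevant.)
Coloring : ℕ → Set
Coloring n = V n → V n → Bool

oddRed : ∀ {n} → Coloring n → SqDatum n → Bool
oddRed c (u , i , j , k , l) =
  let a = (u ⊕ i) ⊕ j
      b = (u ⊕ k) ⊕ l
      d = (a ⊕ k) ⊕ l
  in c u a xor c u b xor c a d xor c b d

-- Fix a vertex u and five coordinates. The ten vertices obtained from u by negating two of the five
-- coordinates correspond to the edges of K₅, and each 4-cycle of K₅ gives a 2×2 square on them. Each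
-- side of one of these fifteen squares is a side of exactly one other, so the numbers of red sides of
-- the fifteen squares have even sum; as fifteen is odd, at most fourteen of the squares are odd.
-- Averaging over u and over the ordered tuples of five distinct coordinates reaches every 2×2 square
-- equally often in each of the fifteen positions, which gives the bound 14/15.

module Submission where

open import Defs
open import Data.Nat using (ℕ; zero; suc; _+_; _*_; _∸_; _≤_; _<_; z≤n; s≤s; >-nonZero)
open import Data.List using (List; []; _∷_; _++_; length; filterᵇ; map; concatMap; allFin)
open import Relation.Binary.PropositionalEquality
  using (_≡_; _≢_; refl; sym; trans; cong; cong₂; subst; module ≡-Reasoning)

open import Data.Bool using (Bool; true; false; not; _∧_; _∨_; _xor_)
open import Data.Bool.Properties
  using (xor-assoc; xor-comm; xor-same; xor-identityʳ; ∧-conicalˡ; ∧-conicalʳ; ∧-identityʳ; ∧-zeroʳ; not-involutive)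
  renaming (_≟_ to _≟ᵇ_)
open import Data.Empty using (⊥-elim)
open import Data.Fin using (Fin; zero; suc; _≟_; #_)
import Data.List as List
open import Data.List.Properties using (length-tabulate; map-tabulate)
open import Data.List.Relation.Unary.Any using (Any; here; there; any?; _─_)
open import Data.Nat.Properties hiding (_≟_)
open import Algebra.Properties.CommutativeSemigroup +-commutativeSemigroup using (interchange)
open import Algebra.Properties.CommutativeSemigroup *-commutativeSemigroup
  using () renaming (x∙yz≈y∙xz to *-left-comm)
open import Data.Product using (_×_; _,_; uncurry)
open import Data.Sum using (_⊎_; inj₁; inj₂)
open import Data.Vec using (Vec; []; _∷_)
import Data.Vec as Vec
open import Data.Vec.Properties
  using (≡-dec; map-lookup-allFin; updateAt-updateAt; updateAt-id-local; updateAt-commutes)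
open import Function using (_∘_; id)
open import Level using (Level)
open import Relation.Nullary.Decidable using (Dec; does; yes; no; isYes≗does; _×-dec_; _⊎-dec_)

private
  variable
    ℓ ℓ′ : Level
    A : Set ℓ
    B : Set ℓ′

⟦_⟧ : Bool → ℕ
⟦ true ⟧ = 1
⟦ false ⟧ = 0

∑ : List A → (A → ℕ) → ℕ
∑ [] f = 0
∑ (x ∷ xs) f = f x + ∑ xs f

syntax ∑ xs (λ x → e) = ∑[ x ∈ xs ] e

∑-cong : ∀ (xs : List A) {f g : A → ℕ} → (∀ x → f x ≡ g x) → ∑ xs f ≡ ∑ xs g
∑-cong [] f≡g = refl
∑-cong (x ∷ xs) f≡g = cong₂ _+_ (f≡g x) (∑-cong xs f≡g)

∑-mono : ∀ (xs : List A) {f g : A → ℕ} → (∀ x → f x ≤ g x) → ∑ xs f ≤ ∑ xs g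
∑-mono [] f≤g = z≤n
∑-mono (x ∷ xs) f≤g = +-mono-≤ (f≤g x) (∑-mono xs f≤g)

∑-const : ∀ (xs : List A) k → ∑[ x ∈ xs ] k ≡ length xs * k
∑-const [] k = refl
∑-const (x ∷ xs) k = cong (k +_) (∑-const xs k)

∑-zero : ∀ (xs : List A) → ∑[ x ∈ xs ] 0 ≡ 0
∑-zero xs = trans (∑-const xs 0) (*-zeroʳ (length xs))

∑-+ : ∀ (xs : List A) (f g : A → ℕ) → ∑[ x ∈ xs ] (f x + g x) ≡ ∑ xs f + ∑ xs g
∑-+ [] f g = refl
∑-+ (x ∷ xs) f g =
  trans (cong (f x + g x +_) (∑-+ xs f g)) (interchange (f x) (g x) (∑ xs f) (∑ xs g))

∑-*ˡ : ∀ (xs : List A) k (f : A → ℕ) → ∑[ x ∈ xs ] (k * f x) ≡ k * ∑ xs f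
∑-*ˡ [] k f = sym (*-zeroʳ k)
∑-*ˡ (x ∷ xs) k f = trans (cong (k * f x +_) (∑-*ˡ xs k f)) (sym (*-distribˡ-+ k (f x) (∑ xs f)))

∑-*ʳ : ∀ (xs : List A) k (f : A → ℕ) → ∑[ x ∈ xs ] (f x * k) ≡ ∑ xs f * k
∑-*ʳ xs k f = trans (∑-cong xs (λ x → *-comm (f x) k)) (trans (∑-*ˡ xs k f) (*-comm k (∑ xs f)))

∑-swap : ∀ (xs : List A) (ys : List B) (f : A → B → ℕ) →
  ∑[ x ∈ xs ] ∑ ys (f x) ≡ ∑[ y ∈ ys ] ∑[ x ∈ xs ] f x y
∑-swap [] ys f = sym (∑-zero ys)
∑-swap (x ∷ xs) ys f =
  trans (cong (∑ ys (f x) +_) (∑-swap xs ys f)) (sym (∑-+ ys (f x) (λ y → ∑[ x ∈ xs ] f x y)))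

∑-++ : ∀ (xs ys : List A) (f : A → ℕ) → ∑ (xs ++ ys) f ≡ ∑ xs f + ∑ ys f
∑-++ [] ys f = refl
∑-++ (x ∷ xs) ys f = trans (cong (f x +_) (∑-++ xs ys f)) (sym (+-assoc (f x) (∑ xs f) (∑ ys f)))

∑-concatMap : ∀ (g : A → List B) (xs : List A) (f : B → ℕ) →
  ∑ (concatMap g xs) f ≡ ∑[ x ∈ xs ] ∑ (g x) f
∑-concatMap g [] f = refl
∑-concatMap g (x ∷ xs) f =
  trans (∑-++ (g x) (concatMap g xs) f) (cong (∑ (g x) f +_) (∑-concatMap g xs f))

∑-map : ∀ (g : A → B) (xs : List A) (f : B → ℕ) → ∑ (map g xs) f ≡ ∑ xs (f ∘ g)
∑-map g [] f = refl
∑-map g (x ∷ xs) f = cong (f (g x) +_) (∑-map g xs f)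

∑-filterᵇ : ∀ (p : A → Bool) (xs : List A) (f : A → ℕ) →
  ∑ (filterᵇ p xs) f ≡ ∑[ x ∈ xs ] (⟦ p x ⟧ * f x)
∑-filterᵇ p [] f = refl
∑-filterᵇ p (x ∷ xs) f with p x
... | true = cong₂ _+_ (sym (+-identityʳ (f x))) (∑-filterᵇ p xs f)
... | false = ∑-filterᵇ p xs f

length≡∑1 : ∀ (xs : List A) → length xs ≡ ∑[ x ∈ xs ] 1
length≡∑1 xs = sym (trans (∑-const xs 1) (*-identityʳ (length xs)))

length-filterᵇ : ∀ (p : A → Bool) xs → length (filterᵇ p xs) ≡ ∑[ x ∈ xs ] ⟦ p x ⟧
length-filterᵇ p xs =
  trans (length≡∑1 (filterᵇ p xs))
        (trans (∑-filterᵇ p xs (λ _ → 1)) (∑-cong xs (λ x → *-identityʳ ⟦ p x ⟧)))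

∑ᵛ : ∀ {n} k → (Vec (Fin n) k → ℕ) → ℕ
∑ᵛ zero F = F []
∑ᵛ {n} (suc k) F = ∑[ x ∈ allFin n ] ∑ᵛ k (λ v → F (x ∷ v))

∑ᵛ-cong : ∀ {n} k {F G : Vec (Fin n) k → ℕ} → (∀ v → F v ≡ G v) → ∑ᵛ k F ≡ ∑ᵛ k G
∑ᵛ-cong zero F≡G = F≡G []
∑ᵛ-cong {n} (suc k) F≡G = ∑-cong (allFin n) (λ x → ∑ᵛ-cong k (λ v → F≡G (x ∷ v)))

∑ᵛ-mono : ∀ {n} k {F G : Vec (Fin n) k → ℕ} → (∀ v → F v ≤ G v) → ∑ᵛ k F ≤ ∑ᵛ k G
∑ᵛ-mono zero F≤G = F≤G []
∑ᵛ-mono {n} (suc k) F≤G = ∑-mono (allFin n) (λ x → ∑ᵛ-mono k (λ v → F≤G (x ∷ v)))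

∑ᵛ-*ˡ : ∀ {n} k m (F : Vec (Fin n) k → ℕ) → ∑ᵛ k (λ v → m * F v) ≡ m * ∑ᵛ k F
∑ᵛ-*ˡ zero m F = refl
∑ᵛ-*ˡ {n} (suc k) m F =
  trans (∑-cong (allFin n) (λ x → ∑ᵛ-*ˡ k m (λ v → F (x ∷ v)))) (∑-*ˡ (allFin n) m _)

∑-∑ᵛ : ∀ {n} (xs : List A) k (F : A → Vec (Fin n) k → ℕ) →
  ∑[ x ∈ xs ] ∑ᵛ k (F x) ≡ ∑ᵛ k (λ v → ∑[ x ∈ xs ] F x v)
∑-∑ᵛ xs zero F = refl
∑-∑ᵛ {n = n} xs (suc k) F =
  trans (∑-swap xs (allFin n) (λ x y → ∑ᵛ k (λ v → F x (y ∷ v))))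
        (∑-cong (allFin n) (λ y → ∑-∑ᵛ xs k (λ x v → F x (y ∷ v))))

swapAt : ∀ {k} → Fin k → Vec A (suc k) → Vec A (suc k)
swapAt zero (x ∷ y ∷ v) = y ∷ x ∷ v
swapAt (suc p) (x ∷ v) = x ∷ swapAt p v

permute : ∀ {k} → List (Fin k) → Vec A (suc k) → Vec A (suc k)
permute [] v = v
permute (p ∷ ps) v = swapAt p (permute ps v)

permute-map : ∀ {k} (f : A → B) (ps : List (Fin k)) v → permute ps (Vec.map f v) ≡ Vec.map f (permute ps v)
permute-map f [] v = refl
permute-map f (p ∷ ps) v = trans (cong (swapAt p) (permute-map f ps v)) (swapAt-map p (permute ps v))
  where
  swapAt-map : ∀ {k} (p : Fin k) v → swapAt p (Vec.map f v) ≡ Vec.map f (swapAt p v)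
  swapAt-map zero (x ∷ y ∷ v) = refl
  swapAt-map (suc p) (x ∷ v) = cong (f x ∷_) (swapAt-map p v)

∑ᵛ-swapAt : ∀ {n k} (p : Fin k) (F : Vec (Fin n) (suc k) → ℕ) →
  ∑ᵛ (suc k) (F ∘ swapAt p) ≡ ∑ᵛ (suc k) F
∑ᵛ-swapAt {n} {suc k} zero F = ∑-swap (allFin n) (allFin n) (λ x y → ∑ᵛ k (λ v → F (y ∷ x ∷ v)))
∑ᵛ-swapAt {n} (suc p) F = ∑-cong (allFin n) (λ x → ∑ᵛ-swapAt p (λ v → F (x ∷ v)))

∑ᵛ-permute : ∀ {n k} (ps : List (Fin k)) (F : Vec (Fin n) (suc k) → ℕ) →
  ∑ᵛ (suc k) (F ∘ permute ps) ≡ ∑ᵛ (suc k) F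
∑ᵛ-permute [] F = refl
∑ᵛ-permute (p ∷ ps) F = trans (∑ᵛ-permute ps (F ∘ swapAt p)) (∑ᵛ-swapAt p F)

_∈ᵇ_ : ∀ {n k} → Fin n → Vec (Fin n) k → Bool
x ∈ᵇ [] = false
x ∈ᵇ (y ∷ v) = does (x ≟ y) ∨ x ∈ᵇ v

allDistinct : ∀ {n k} → Vec (Fin n) k → Bool
allDistinct [] = true
allDistinct (x ∷ v) = not (x ∈ᵇ v) ∧ allDistinct v

≟-sym : ∀ {n} (x y : Fin n) → does (x ≟ y) ≡ does (y ≟ x)
≟-sym x y with x ≟ y | y ≟ x
... | yes _ | yes _ = refl
... | no _ | no _ = refl
... | yes x≡y | no y≢x = ⊥-elim (y≢x (sym x≡y))
... | no x≢y | yes y≡x = ⊥-elim (x≢y (sym y≡x))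

∈ᵇ-swapAt : ∀ {n k} (x : Fin n) (p : Fin k) v → x ∈ᵇ swapAt p v ≡ x ∈ᵇ v
∈ᵇ-swapAt x zero (y ∷ z ∷ v) = ∨-left-comm (does (x ≟ z)) (does (x ≟ y)) (x ∈ᵇ v)
  where
  ∨-left-comm : ∀ a b c → a ∨ (b ∨ c) ≡ b ∨ (a ∨ c)
  ∨-left-comm true true c = refl
  ∨-left-comm true false c = refl
  ∨-left-comm false b c = refl
∈ᵇ-swapAt x (suc p) (y ∷ v) = cong (does (x ≟ y) ∨_) (∈ᵇ-swapAt x p v)

allDistinct-swapAt : ∀ {n k} (p : Fin k) (v : Vec (Fin n) (suc k)) →
  allDistinct (swapAt p v) ≡ allDistinct v
allDistinct-swapAt zero (x ∷ y ∷ v) rewrite ≟-sym y x =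
  exchange (does (x ≟ y)) (y ∈ᵇ v) (x ∈ᵇ v) (allDistinct v)
  where
  exchange : ∀ e p q r → not (e ∨ p) ∧ (not q ∧ r) ≡ not (e ∨ q) ∧ (not p ∧ r)
  exchange true p q r = refl
  exchange false true true r = refl
  exchange false true false r = refl
  exchange false false q r = refl
allDistinct-swapAt (suc p) (x ∷ v) =
  cong₂ (λ b c → not b ∧ c) (∈ᵇ-swapAt x p v) (allDistinct-swapAt p v)

allDistinct-permute : ∀ {n k} (ps : List (Fin k)) (v : Vec (Fin n) (suc k)) →
  allDistinct (permute ps v) ≡ allDistinct v
allDistinct-permute [] v = refl
allDistinct-permute (p ∷ ps) v = trans (allDistinct-swapAt p (permute ps v)) (allDistinct-permute ps v)

∑-allFin-suc : ∀ {n} (f : Fin (suc n) → ℕ) →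
  ∑ (allFin (suc n)) f ≡ f zero + ∑[ x ∈ allFin n ] f (suc x)
∑-allFin-suc {n} f =
  cong (f zero +_) (trans (cong (λ xs → ∑ xs f) (sym (map-tabulate id suc))) (∑-map suc (allFin n) f))

∑⟦≟⟧≡1 : ∀ {n} (y : Fin n) → ∑[ x ∈ allFin n ] ⟦ does (x ≟ y) ⟧ ≡ 1
∑⟦≟⟧≡1 {suc n} zero =
  trans (∑-allFin-suc {n} (λ x → ⟦ does (x ≟ zero) ⟧)) (cong suc (∑-zero (allFin n)))
∑⟦≟⟧≡1 {suc n} (suc y) = trans (∑-allFin-suc {n} (λ x → ⟦ does (x ≟ suc y) ⟧)) (∑⟦≟⟧≡1 y)

∑⟦∉⟧+k≡n : ∀ {n k} (v : Vec (Fin n) k) → allDistinct v ≡ true →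
  ∑[ x ∈ allFin n ] ⟦ not (x ∈ᵇ v) ⟧ + k ≡ n
∑⟦∉⟧+k≡n {n} [] _ = trans (+-identityʳ _) (trans (sym (length≡∑1 (allFin n))) (length-tabulate id))
∑⟦∉⟧+k≡n {n} {suc k} (y ∷ v) distinct = begin
  rest + suc k                                      ≡⟨ +-assoc rest 1 k ⟨
  rest + 1 + k                                      ≡⟨ cong (λ m → rest + m + k) (∑⟦≟⟧≡1 y) ⟨
  rest + ∑[ x ∈ allFin n ] ⟦ does (x ≟ y) ⟧ + k
    ≡⟨ cong (_+ k) (trans (sym (∑-+ (allFin n) _ _)) (∑-cong (allFin n) remove-y)) ⟩
  ∑[ x ∈ allFin n ] ⟦ not (x ∈ᵇ v) ⟧ + k            ≡⟨ ∑⟦∉⟧+k≡n v (∧-conicalʳ _ _ distinct) ⟩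
  n                                                 ∎
  where
  open ≡-Reasoning
  rest : ℕ
  rest = ∑[ x ∈ allFin n ] ⟦ not (x ∈ᵇ (y ∷ v)) ⟧
  remove-y : ∀ x → ⟦ not (x ∈ᵇ (y ∷ v)) ⟧ + ⟦ does (x ≟ y) ⟧ ≡ ⟦ not (x ∈ᵇ v) ⟧
  remove-y x with x ≟ y
  ... | yes refl = cong ⟦_⟧ (sym (∧-conicalˡ _ _ distinct))
  ... | no _ = +-identityʳ _

∑-extensions : ∀ {n k} (v : Vec (Fin n) k) X →
  ∑[ x ∈ allFin n ] (⟦ allDistinct (x ∷ v) ⟧ * X) ≡ (n ∸ k) * (⟦ allDistinct v ⟧ * X)
∑-extensions {n} {k} v X with allDistinct v in distinct
... | false = trans (∑-cong (allFin n) (λ x → cong (λ b → ⟦ b ⟧ * X) (∧-zeroʳ (not (x ∈ᵇ v)))))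
                   (trans (∑-zero (allFin n)) (sym (*-zeroʳ (n ∸ k))))
... | true = begin
  ∑[ x ∈ allFin n ] (⟦ not (x ∈ᵇ v) ∧ true ⟧ * X)
    ≡⟨ ∑-cong (allFin n) (λ x → cong (λ b → ⟦ b ⟧ * X) (∧-identityʳ (not (x ∈ᵇ v)))) ⟩
  ∑[ x ∈ allFin n ] (⟦ not (x ∈ᵇ v) ⟧ * X)          ≡⟨ ∑-*ʳ (allFin n) X (λ x → ⟦ not (x ∈ᵇ v) ⟧) ⟩
  ∑[ x ∈ allFin n ] ⟦ not (x ∈ᵇ v) ⟧ * X            ≡⟨ cong (_* X) (m+n∸n≡m _ k) ⟨
  (∑[ x ∈ allFin n ] ⟦ not (x ∈ᵇ v) ⟧ + k ∸ k) * X  ≡⟨ cong (λ m → (m ∸ k) * X) (∑⟦∉⟧+k≡n v distinct) ⟩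
  (n ∸ k) * X                                       ≡⟨ cong ((n ∸ k) *_) (*-identityˡ X) ⟨
  (n ∸ k) * (1 * X)                                 ∎
  where open ≡-Reasoning

allDistinct≡distinct4 : ∀ {n} (i j k l : Fin n) → allDistinct (i ∷ j ∷ k ∷ l ∷ []) ≡ distinct4 i j k l
allDistinct≡distinct4 i j k l
  rewrite isYes≗does (i ≟ j) | isYes≗does (i ≟ k) | isYes≗does (i ≟ l)
        | isYes≗does (j ≟ k) | isYes≗does (j ≟ l) | isYes≗does (k ≟ l)
  = regroup (does (i ≟ j)) (does (i ≟ k)) (does (i ≟ l)) (does (j ≟ k)) (does (j ≟ l)) (does (k ≟ l))
  where
  regroup : ∀ a b c d e f →
    not (a ∨ b ∨ c ∨ false) ∧ not (d ∨ e ∨ false) ∧ not (f ∨ false) ∧ not false ∧ true ≡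
    not (a ∨ b ∨ c ∨ d ∨ e ∨ f)
  regroup true b c d e f = refl
  regroup false true c d e f = refl
  regroup false false true d e f = refl
  regroup false false false true e f = refl
  regroup false false false false true f = refl
  regroup false false false false false true = refl
  regroup false false false false false false = refl

⊕-involutive : ∀ {n} (v : V n) i → (v ⊕ i) ⊕ i ≡ v
⊕-involutive v i = trans (updateAt-updateAt i v) (updateAt-id-local i v (not-involutive _))

⊕-comm : ∀ {n} (v : V n) i j → (v ⊕ i) ⊕ j ≡ (v ⊕ j) ⊕ i
⊕-comm v i j with i ≟ j
... | yes refl = refl
... | no i≢j = updateAt-commutes j i (i≢j ∘ sym) v

∑-allV-suc : ∀ {n} (F : V (suc n) → ℕ) →
  ∑ (allV (suc n)) F ≡ ∑[ v ∈ allV n ] (F (false ∷ v) + F (true ∷ v))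
∑-allV-suc {n} F =
  trans (∑-concatMap (λ v → (false ∷ v) ∷ (true ∷ v) ∷ []) (allV n) F)
        (∑-cong (allV n) (λ v → cong (F (false ∷ v) +_) (+-identityʳ (F (true ∷ v)))))

∑-allV-⊕ : ∀ {n} (i : Fin n) (F : V n → ℕ) → ∑[ u ∈ allV n ] F (u ⊕ i) ≡ ∑ (allV n) F
∑-allV-⊕ {suc n} zero F = begin
  ∑[ u ∈ allV (suc n) ] F (u ⊕ zero)                 ≡⟨ ∑-allV-suc (λ u → F (u ⊕ zero)) ⟩
  ∑[ v ∈ allV n ] (F (true ∷ v) + F (false ∷ v))     ≡⟨ ∑-cong (allV n) (λ v → +-comm (F (true ∷ v)) _) ⟩
  ∑[ v ∈ allV n ] (F (false ∷ v) + F (true ∷ v))     ≡⟨ ∑-allV-suc F ⟨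
  ∑ (allV (suc n)) F                                 ∎
  where open ≡-Reasoning
∑-allV-⊕ {suc n} (suc i) F = begin
  ∑[ u ∈ allV (suc n) ] F (u ⊕ suc i)
    ≡⟨ ∑-allV-suc (λ u → F (u ⊕ suc i)) ⟩
  ∑[ v ∈ allV n ] (F (false ∷ (v ⊕ i)) + F (true ∷ (v ⊕ i)))
    ≡⟨ ∑-allV-⊕ i (λ v → F (false ∷ v) + F (true ∷ v)) ⟩
  ∑[ v ∈ allV n ] (F (false ∷ v) + F (true ∷ v))
    ≡⟨ ∑-allV-suc F ⟨
  ∑ (allV (suc n)) F ∎
  where open ≡-Reasoning

origin : ∀ {k} → V k
origin = Vec.replicate _ false

embed : ∀ {n k} → V n → Vec (Fin n) k → V k → V n
embed u [] [] = u
embed u (x ∷ s) (false ∷ m) = embed u s m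
embed u (x ∷ s) (true ∷ m) = embed u s m ⊕ x

embed-⊕ : ∀ {n k} (u : V n) (s : Vec (Fin n) k) m y → embed u s (m ⊕ y) ≡ embed u s m ⊕ Vec.lookup s y
embed-⊕ u (x ∷ s) (false ∷ m) zero = refl
embed-⊕ u (x ∷ s) (true ∷ m) zero = sym (⊕-involutive (embed u s m) x)
embed-⊕ u (x ∷ s) (false ∷ m) (suc y) = embed-⊕ u s m y
embed-⊕ u (x ∷ s) (true ∷ m) (suc y) =
  trans (cong (_⊕ x) (embed-⊕ u s m y)) (⊕-comm (embed u s m) (Vec.lookup s y) x)

embed-origin : ∀ {n k} (u : V n) (s : Vec (Fin n) k) → embed u s origin ≡ u
embed-origin u [] = refl
embed-origin u (x ∷ s) = embed-origin u s

square : ∀ {n} → V n → Vec (Fin n) 4 → SqDatum n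
square u (i ∷ j ∷ k ∷ l ∷ []) = (u , i , j , k , l)

⊕⊕-natural : ∀ {n d} (φ : V d → V n) (τ : Fin d → Fin n) → (∀ v x → φ (v ⊕ x) ≡ φ v ⊕ τ x) →
  ∀ v x y → φ ((v ⊕ x) ⊕ y) ≡ (φ v ⊕ τ x) ⊕ τ y
⊕⊕-natural φ τ φ-⊕ v x y = trans (φ-⊕ (v ⊕ x) y) (cong (_⊕ τ y) (φ-⊕ v x))

oddRed-natural : ∀ {n d} (c : Coloring n) (φ : V d → V n) (τ : Fin d → Fin n) →
  (∀ v x → φ (v ⊕ x) ≡ φ v ⊕ τ x) →
  ∀ v i j k l →
  oddRed c (φ v , τ i , τ j , τ k , τ l) ≡ oddRed (λ x y → c (φ x) (φ y)) (v , i , j , k , l)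
oddRed-natural c φ τ φ-⊕ v i j k l
  rewrite ⊕⊕-natural φ τ φ-⊕ ((v ⊕ i) ⊕ j) k l | ⊕⊕-natural φ τ φ-⊕ v i j | ⊕⊕-natural φ τ φ-⊕ v k l
  = refl

-- The square with vertices u ⊕ x ⊕ y for the four edges xy of the 4-cycle a–c–b–d–a; r is unused.
cycleSquare : ∀ {n} → V n → Vec (Fin n) 5 → SqDatum n
cycleSquare u (r ∷ a ∷ b ∷ c ∷ d ∷ []) = ((u ⊕ c) ⊕ a , a , b , c , d)

cycleSquare-natural : ∀ {n d} (c : Coloring n) (φ : V d → V n) (τ : Fin d → Fin n) →
  (∀ v x → φ (v ⊕ x) ≡ φ v ⊕ τ x) →
  ∀ v σ →
  oddRed c (cycleSquare (φ v) (Vec.map τ σ)) ≡ oddRed (λ x y → c (φ x) (φ y)) (cycleSquare v σ)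
cycleSquare-natural c φ τ φ-⊕ v (r ∷ a ∷ b ∷ c′ ∷ d ∷ []) =
  trans (cong (λ w → oddRed c (w , τ a , τ b , τ c′ , τ d)) (sym (⊕⊕-natural φ τ φ-⊕ v c′ a)))
        (oddRed-natural c φ τ φ-⊕ ((v ⊕ c′) ⊕ a) a b c′ d)

sides : ∀ {n} → SqDatum n → List (V n × V n)
sides {n} (u , i , j , k , l) = (u , a) ∷ (u , b) ∷ (a , d) ∷ (b , d) ∷ []
  where
  a b d : V n
  a = (u ⊕ i) ⊕ j
  b = (u ⊕ k) ⊕ l
  d = (a ⊕ k) ⊕ l

parity : ∀ {n} → Coloring n → List (V n × V n) → Bool
parity c [] = false
parity c ((x , y) ∷ es) = c x y xor parity c es

xorᴸ : List Bool → Bool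
xorᴸ = List.foldr _xor_ false

parity-++ : ∀ {n} (c : Coloring n) es fs → parity c (es ++ fs) ≡ parity c es xor parity c fs
parity-++ c [] fs = refl
parity-++ c ((x , y) ∷ es) fs = trans (cong (c x y xor_) (parity-++ c es fs)) (sym (xor-assoc (c x y) _ _))

parity-sides : ∀ {n} (c : Coloring n) ds → parity c (concatMap sides ds) ≡ xorᴸ (map (oddRed c) ds)
parity-sides c [] = refl
parity-sides c (d ∷ ds) =
  trans (parity-++ c (sides d) (concatMap sides ds)) (cong₂ _xor_ (oddRed-sides d) (parity-sides c ds))
  where
  oddRed-sides : ∀ d → parity c (sides d) ≡ oddRed c d
  oddRed-sides (u , i , j , k , l) = cong (λ z → c u _ xor c u _ xor c _ _ xor z) (xor-identityʳ _)

_≈ᵉ_ : ∀ {n} → V n × V n → V n × V n → Set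
(x , y) ≈ᵉ (x′ , y′) = (x ≡ x′ × y ≡ y′) ⊎ (x ≡ y′ × y ≡ x′)

_≈ᵉ?_ : ∀ {n} (e e′ : V n × V n) → Dec (e ≈ᵉ e′)
(x , y) ≈ᵉ? (x′ , y′) = ((x ≟ᵛ x′) ×-dec (y ≟ᵛ y′)) ⊎-dec ((x ≟ᵛ y′) ×-dec (y ≟ᵛ x′))
  where
  _≟ᵛ_ : ∀ {n} (v w : V n) → Dec (v ≡ w)
  _≟ᵛ_ = ≡-dec _≟ᵇ_

-- Deletes pairs of equal undirected edges; the fuel only serves termination.
cancelPairs : ∀ {n} → ℕ → List (V n × V n) → List (V n × V n)
cancelPairs zero es = es
cancelPairs (suc fuel) [] = []
cancelPairs (suc fuel) (e ∷ es) with any? (e ≈ᵉ?_) es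
... | yes e∈es = cancelPairs fuel (es ─ e∈es)
... | no _ = e ∷ cancelPairs fuel es

module _ {n} (c : Coloring n) (c-sym : ∀ u v → c u v ≡ c v u) where

  parity-─ : ∀ {e es} (e∈es : Any (e ≈ᵉ_) es) →
    parity c es ≡ uncurry c e xor parity c (es ─ e∈es)
  parity-─ {x , y} {(x′ , y′) ∷ es} (here (inj₁ (refl , refl))) = refl
  parity-─ {x , y} {(x′ , y′) ∷ es} (here (inj₂ (refl , refl))) = cong (_xor parity c es) (c-sym x′ y′)
  parity-─ {x , y} {(x′ , y′) ∷ es} (there e∈es) =
    trans (cong (c x′ y′ xor_) (parity-─ e∈es))
          (xor-left-comm (c x′ y′) (c x y) (parity c (es ─ e∈es)))
    where
    xor-left-comm : ∀ a b d → a xor (b xor d) ≡ b xor (a xor d)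
    xor-left-comm a b d =
      trans (sym (xor-assoc a b d)) (trans (cong (_xor d) (xor-comm a b)) (xor-assoc b a d))

  parity-cancelPairs : ∀ fuel es → parity c (cancelPairs fuel es) ≡ parity c es
  parity-cancelPairs zero es = refl
  parity-cancelPairs (suc fuel) [] = refl
  parity-cancelPairs (suc fuel) ((x , y) ∷ es) with any? ((x , y) ≈ᵉ?_) es
  ... | yes e∈es = begin
    parity c (cancelPairs fuel (es ─ e∈es))      ≡⟨ parity-cancelPairs fuel (es ─ e∈es) ⟩
    parity c (es ─ e∈es)                         ≡⟨ cong (_xor parity c (es ─ e∈es)) (xor-same (c x y)) ⟨
    (c x y xor c x y) xor parity c (es ─ e∈es)   ≡⟨ xor-assoc (c x y) (c x y) _ ⟩
    c x y xor (c x y xor parity c (es ─ e∈es))   ≡⟨ cong (c x y xor_) (parity-─ e∈es) ⟨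
    c x y xor parity c es                        ∎
    where open ≡-Reasoning
  ... | no _ = cong (c x y xor_) (parity-cancelPairs fuel es)

∑⟦⟧≤length : ∀ bs → ∑[ b ∈ bs ] ⟦ b ⟧ ≤ length bs
∑⟦⟧≤length [] = z≤n
∑⟦⟧≤length (true ∷ bs) = s≤s (∑⟦⟧≤length bs)
∑⟦⟧≤length (false ∷ bs) = m≤n⇒m≤1+n (∑⟦⟧≤length bs)

∑⟦⟧≡length⇒all-true : ∀ bs → ∑[ b ∈ bs ] ⟦ b ⟧ ≡ length bs →
  bs ≡ List.replicate (length bs) true
∑⟦⟧≡length⇒all-true [] _ = refl
∑⟦⟧≡length⇒all-true (true ∷ bs) eq = cong (true ∷_) (∑⟦⟧≡length⇒all-true bs (suc-injective eq))
∑⟦⟧≡length⇒all-true (false ∷ bs) eq =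
  ⊥-elim (<-irrefl refl (subst (_≤ length bs) eq (∑⟦⟧≤length bs)))

∑⟦⟧<length : ∀ bs → xorᴸ bs ≢ xorᴸ (List.replicate (length bs) true) →
  ∑[ b ∈ bs ] ⟦ b ⟧ < length bs
∑⟦⟧<length bs xor≢ = ≤∧≢⇒< (∑⟦⟧≤length bs) (xor≢ ∘ cong xorᴸ ∘ ∑⟦⟧≡length⇒all-true bs)

-- The fifteen squares of the 4-cycles of K₅

-- permute (pairing ++ front) first moves one coordinate r to the front and then orders the other
-- four so that, through cycleSquare, the three pairings give the three 4-cycles on them.
fourCycles : List (List (Fin 4))
fourCycles = List.cartesianProductWith _++_
  ([] ∷ (# 2 ∷ []) ∷ (# 2 ∷ # 3 ∷ []) ∷ [])
  ([] ∷ (# 0 ∷ []) ∷ (# 0 ∷ # 1 ∷ []) ∷ (# 0 ∷ # 1 ∷ # 2 ∷ []) ∷ (# 0 ∷ # 1 ∷ # 2 ∷ # 3 ∷ []) ∷ [])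

fourCycleSquare : List (Fin 4) → SqDatum 5
fourCycleSquare ps = cycleSquare origin (permute ps (Vec.allFin 5))

fourCycleSquares : List (SqDatum 5)
fourCycleSquares = map fourCycleSquare fourCycles

-- cancelPairs empties the 60 sides: every side of these squares is a side of exactly two of them.
fourCycleSquares-parity : ∀ (c : Coloring 5) → (∀ u v → c u v ≡ c v u) →
  xorᴸ (map (oddRed c) fourCycleSquares) ≡ false
fourCycleSquares-parity c c-sym =
  trans (sym (parity-sides c fourCycleSquares))
        (sym (parity-cancelPairs c c-sym 60 (concatMap sides fourCycleSquares)))

oddRed-cycleSquare-permute : ∀ {n} (c : Coloring n) (u : V n) (s : Vec (Fin n) 5) ps →
  oddRed c (cycleSquare u (permute ps s)) ≡
  oddRed (λ x y → c (embed u s x) (embed u s y)) (fourCycleSquare ps)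
oddRed-cycleSquare-permute c u s ps = begin
  oddRed c (cycleSquare u (permute ps s))
    ≡⟨ cong (λ w → oddRed c (cycleSquare w (permute ps s))) (embed-origin u s) ⟨
  oddRed c (cycleSquare (embed u s origin) (permute ps s))
    ≡⟨ cong (λ σ → oddRed c (cycleSquare (embed u s origin) σ))
            (trans (sym (permute-map (Vec.lookup s) ps (Vec.allFin 5)))
                   (cong (permute ps) (map-lookup-allFin s))) ⟨
  oddRed c (cycleSquare (embed u s origin) (Vec.map (Vec.lookup s) (permute ps (Vec.allFin 5))))
    ≡⟨ cycleSquare-natural c (embed u s) (Vec.lookup s) (embed-⊕ u s) origin (permute ps (Vec.allFin 5)) ⟩
  oddRed (λ x y → c (embed u s x) (embed u s y)) (fourCycleSquare ps) ∎
  where open ≡-Reasoning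

∑-fourCycles-oddRed≤14 : ∀ {n} (c : Coloring n) → (∀ u v → c u v ≡ c v u) →
  ∀ u s → ∑[ ps ∈ fourCycles ] ⟦ oddRed c (cycleSquare u (permute ps s)) ⟧ ≤ 14
∑-fourCycles-oddRed≤14 c c-sym u s = begin
  ∑[ ps ∈ fourCycles ] ⟦ oddRed c (cycleSquare u (permute ps s)) ⟧
    ≡⟨ ∑-cong fourCycles (cong ⟦_⟧ ∘ oddRed-cycleSquare-permute c u s) ⟩
  ∑[ ps ∈ fourCycles ] ⟦ oddRed c′ (fourCycleSquare ps) ⟧
    ≡⟨ trans (∑-map (oddRed c′) fourCycleSquares ⟦_⟧)
             (∑-map fourCycleSquare fourCycles (⟦_⟧ ∘ oddRed c′)) ⟨
  ∑[ b ∈ map (oddRed c′) fourCycleSquares ] ⟦ b ⟧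
    ≤⟨ ≤-pred (∑⟦⟧<length (map (oddRed c′) fourCycleSquares) parity≢true) ⟩
  14 ∎
  where
  open ≤-Reasoning
  c′ : Coloring 5
  c′ x y = c (embed u s x) (embed u s y)
  parity≢true : xorᴸ (map (oddRed c′) fourCycleSquares) ≢ true
  parity≢true eq = false≢true (trans (sym (fourCycleSquares-parity c′ (λ x y → c-sym _ _))) eq)
    where
    false≢true : false ≢ true
    false≢true ()

-- Placements of the 5-cube

placementSum : ∀ {n} → (V n → Vec (Fin n) 5 → ℕ) → ℕ
placementSum {n} F = ∑ᵛ 5 λ s → ⟦ allDistinct s ⟧ * ∑[ u ∈ allV n ] F u s

module _ {n : ℕ} where

  placementSum-mono : {F G : V n → Vec (Fin n) 5 → ℕ} → (∀ u s → F u s ≤ G u s) →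
    placementSum F ≤ placementSum G
  placementSum-mono F≤G =
    ∑ᵛ-mono 5 (λ s → *-monoʳ-≤ ⟦ allDistinct s ⟧ (∑-mono (allV n) (λ u → F≤G u s)))

  placementSum-*ˡ : ∀ m (F : V n → Vec (Fin n) 5 → ℕ) →
    placementSum (λ u s → m * F u s) ≡ m * placementSum F
  placementSum-*ˡ m F =
    trans (∑ᵛ-cong 5 (λ s → trans (cong (⟦ allDistinct s ⟧ *_) (∑-*ˡ (allV n) m (λ u → F u s)))
                                  (*-left-comm ⟦ allDistinct s ⟧ m (∑[ u ∈ allV n ] F u s))))
          (∑ᵛ-*ˡ 5 m (λ s → ⟦ allDistinct s ⟧ * ∑[ u ∈ allV n ] F u s))

  placementSum-∑ : ∀ (ts : List A) (G : A → V n → Vec (Fin n) 5 → ℕ) →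
    placementSum (λ u s → ∑[ t ∈ ts ] G t u s) ≡ ∑[ t ∈ ts ] placementSum (G t)
  placementSum-∑ ts G =
    trans (∑ᵛ-cong 5 (λ s → trans (cong (⟦ allDistinct s ⟧ *_) (∑-swap (allV n) ts (λ u t → G t u s)))
                                  (sym (∑-*ˡ ts ⟦ allDistinct s ⟧ (λ t → ∑[ u ∈ allV n ] G t u s)))))
          (sym (∑-∑ᵛ ts 5 (λ t s → ⟦ allDistinct s ⟧ * ∑[ u ∈ allV n ] G t u s)))

  placementSum-permute : ∀ ps (F : V n → Vec (Fin n) 5 → ℕ) →
    placementSum (λ u s → F u (permute ps s)) ≡ placementSum F
  placementSum-permute ps F =
    trans (∑ᵛ-cong 5 (λ s → cong (λ b → ⟦ b ⟧ * ∑[ u ∈ allV n ] F u (permute ps s))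
                                 (sym (allDistinct-permute ps s))))
          (∑ᵛ-permute ps (λ s → ⟦ allDistinct s ⟧ * ∑[ u ∈ allV n ] F u s))

  placementSum-cycleSquare : ∀ (F : SqDatum n → ℕ) →
    placementSum (λ u s → F (cycleSquare u s)) ≡ placementSum (λ u s → F (square u (Vec.tail s)))
  placementSum-cycleSquare F = ∑ᵛ-cong 5 (λ s → cong (⟦ allDistinct s ⟧ *_) (translate s))
    where
    translate : ∀ s → ∑[ u ∈ allV n ] F (cycleSquare u s) ≡ ∑[ u ∈ allV n ] F (square u (Vec.tail s))
    translate (r ∷ a ∷ b ∷ c ∷ d ∷ []) =
      trans (∑-allV-⊕ c (G ∘ (_⊕ a))) (∑-allV-⊕ a G)
      where
      G : V n → ℕ
      G w = F (square w (a ∷ b ∷ c ∷ d ∷ []))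

  squareData-∑ : ∀ (F : SqDatum n → ℕ) →
    ∑ (squareData n) F ≡ ∑ᵛ 4 (λ v → ⟦ allDistinct v ⟧ * ∑[ u ∈ allV n ] F (square u v))
  squareData-∑ F = begin
    ∑ (squareData n) F
      ≡⟨ trans (∑-concatMap _ (allV n) F) (∑-cong (allV n) λ u →
           trans (∑-concatMap _ I F) (∑-cong I λ i →
           trans (∑-concatMap _ I F) (∑-cong I λ j →
           trans (∑-concatMap _ I F) (∑-cong I λ k →
           trans (∑-map _ (filterᵇ (distinct4 i j k) I) F) (trans (∑-filterᵇ (distinct4 i j k) I _)
                                                                  (∑-cong I λ l →
           cong (λ b → ⟦ b ⟧ * F (u , i , j , k , l)) (sym (allDistinct≡distinct4 i j k l)))))))) ⟩
    ∑[ u ∈ allV n ] ∑ᵛ 4 (λ v → ⟦ allDistinct v ⟧ * F (square u v))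
      ≡⟨ ∑-∑ᵛ (allV n) 4 (λ u v → ⟦ allDistinct v ⟧ * F (square u v)) ⟩
    ∑ᵛ 4 (λ v → ∑[ u ∈ allV n ] (⟦ allDistinct v ⟧ * F (square u v)))
      ≡⟨ ∑ᵛ-cong 4 (λ v → ∑-*ˡ (allV n) ⟦ allDistinct v ⟧ (λ u → F (square u v))) ⟩
    ∑ᵛ 4 (λ v → ⟦ allDistinct v ⟧ * ∑[ u ∈ allV n ] F (square u v)) ∎
    where
    open ≡-Reasoning
    I : List (Fin n)
    I = allFin n

  placementSum-square : ∀ (F : SqDatum n → ℕ) →
    placementSum (λ u s → F (square u (Vec.tail s))) ≡ (n ∸ 4) * ∑ (squareData n) F
  placementSum-square F = begin
    ∑[ x ∈ allFin n ] ∑ᵛ 4 (λ v → ⟦ allDistinct (x ∷ v) ⟧ * G v)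
      ≡⟨ ∑-∑ᵛ (allFin n) 4 (λ x v → ⟦ allDistinct (x ∷ v) ⟧ * G v) ⟩
    ∑ᵛ 4 (λ v → ∑[ x ∈ allFin n ] (⟦ allDistinct (x ∷ v) ⟧ * G v))
      ≡⟨ ∑ᵛ-cong 4 (λ v → ∑-extensions v (G v)) ⟩
    ∑ᵛ 4 (λ v → (n ∸ 4) * (⟦ allDistinct v ⟧ * G v))
      ≡⟨ ∑ᵛ-*ˡ 4 (n ∸ 4) (λ v → ⟦ allDistinct v ⟧ * G v) ⟩
    (n ∸ 4) * ∑ᵛ 4 (λ v → ⟦ allDistinct v ⟧ * G v)
      ≡⟨ cong ((n ∸ 4) *_) (squareData-∑ F) ⟨
    (n ∸ 4) * ∑ (squareData n) F ∎
    where
    open ≡-Reasoning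
    G : Vec (Fin n) 4 → ℕ
    G v = ∑[ u ∈ allV n ] F (square u v)

  placementSum-permute-cycleSquare : ∀ ps (F : SqDatum n → ℕ) →
    placementSum (λ u s → F (cycleSquare u (permute ps s))) ≡ (n ∸ 4) * ∑ (squareData n) F
  placementSum-permute-cycleSquare ps F =
    trans (placementSum-permute ps (λ u s → F (cycleSquare u s)))
          (trans (placementSum-cycleSquare F) (placementSum-square F))

lemma3p3 : (n : ℕ) → 5 ≤ n → (c : Coloring n) → (∀ u v → c u v ≡ c v u) →
    15 * length (filterᵇ (oddRed c) (squareData n)) ≤ 14 * length (squareData n)
lemma3p3 n 5≤n c c-sym = *-cancelˡ-≤ K {{>-nonZero (m<n⇒0<n∸m 5≤n)}} (begin
  K * (15 * L)
    ≡⟨ *-left-comm K 15 L ⟩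
  15 * (K * L)
    ≡⟨ cong (λ l → 15 * (K * l)) (length-filterᵇ (oddRed c) (squareData n)) ⟩
  15 * (K * ∑ (squareData n) odd)
    ≡⟨ ∑-const fourCycles (K * ∑ (squareData n) odd) ⟨
  ∑[ ps ∈ fourCycles ] (K * ∑ (squareData n) odd)
    ≡⟨ ∑-cong fourCycles (λ ps → placementSum-permute-cycleSquare ps odd) ⟨
  ∑[ ps ∈ fourCycles ] placementSum (λ u s → odd (cycleSquare u (permute ps s)))
    ≡⟨ placementSum-∑ fourCycles (λ ps u s → odd (cycleSquare u (permute ps s))) ⟨
  placementSum (λ u s → ∑[ ps ∈ fourCycles ] odd (cycleSquare u (permute ps s)))
    ≤⟨ placementSum-mono (∑-fourCycles-oddRed≤14 c c-sym) ⟩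
  placementSum {n} (λ u s → 14 * 1)
    ≡⟨ placementSum-*ˡ {n} 14 (λ _ _ → 1) ⟩
  14 * placementSum {n} (λ u s → 1)
    ≡⟨ cong (14 *_) (placementSum-square {n} (λ _ → 1)) ⟩
  14 * (K * ∑[ d ∈ squareData n ] 1)
    ≡⟨ cong (λ m → 14 * (K * m)) (length≡∑1 (squareData n)) ⟨
  14 * (K * N)
    ≡⟨ *-left-comm 14 K N ⟩
  K * (14 * N) ∎)
  where
  open ≤-Reasoning
  K L N : ℕ
  K = n ∸ 4
  L = length (filterᵇ (oddRed c) (squareData n))
  N = length (squareData n)
  odd : SqDatum n → ℕ
  odd = ⟦_⟧ ∘ oddRed c
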